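{- Let $t\ge1$, let $k_1',\ldots,k_t'\ge1$ be integers and $\kappa:=\sum_{i=1}^t k_i'$. Let $\hat H$ be a graph on $n$ vertices with vertex set partitioned as $U\sqcup W$. (1) If $e(U)+e(U,W)>\frac{4\kappa+t-2}{2}n$, then $\hat H$ contains $t$ pairwise vertex-disjoint paths on $2k_1'+1,\ldots,2k_t'+1$ vertices respectively, each with both endpoints in $U$. (2) If $2e(U)+e(U,W)>\frac{4\kappa+t-2}{2}(|U|+n)$, then the same conclusion holds.
   Context: $e(U)$ is the number of edges of $\hat H$ with both endpoints in $U$, and $e(U,W)$ is the number of edges with one endpoint in $U$ and the other in $W$. -}

module Defs where

open import Data.Bool using (Bool; true; false; _∧_; _∨_; not; if_then_else_; T)
open import Data.Nat using (ℕ; zero; suc; _+_; _*_; _<ᵇ_)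
open import Data.Nat.ListAction using (sum)
open import Data.List using (List; map; allFin; length; filter)
open import Data.Fin using (Fin; toℕ; zero; suc; inject₁; fromℕ)
open import Relation.Binary.PropositionalEquality using (_≡_)

record Graph (n : ℕ) : Set where
  field
    adj   : Fin n → Fin n → Bool
    sym   : ∀ u v → adj u v ≡ adj v u
    irrefl : ∀ v → adj v v ≡ false
open Graph public

Σfin : (m : ℕ) → (Fin m → ℕ) → ℕ
Σfin m f = sum (map f (allFin m))

bit : Bool → ℕ
bit true  = 1
bit false = 0

-- Number of unordered pairs {u,v} (u ≠ v, counted once via toℕ u < toℕ v)
-- that are edges of G and satisfy the symmetric predicate P.
countEdges : ∀ {n} → Graph n → (Fin n → Fin n → Bool) → ℕ
countEdges {n} G P =
  Σfin n λ u → Σfin n λ v → bit ((toℕ u <ᵇ toℕ v) ∧ adj G u v ∧ P u v)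

-- The vertex partition V = U ⊔ W is given by the indicator of U
-- (W is its complement).

eIn : ∀ {n} → Graph n → (Fin n → Bool) → ℕ
eIn G U = countEdges G (λ u v → U u ∧ U v)

eCross : ∀ {n} → Graph n → (Fin n → Bool) → ℕ
eCross G U = countEdges G (λ u v → (U u ∧ not (U v)) ∨ (not (U u) ∧ U v))

card : ∀ {n} → (Fin n → Bool) → ℕ
card {n} U = Σfin n (λ v → bit (U v))

record Path {n : ℕ} (G : Graph n) (m : ℕ) : Set where
  field
    vert      : Fin m → Fin n
    injective : ∀ a b → vert a ≡ vert b → a ≡ b
    adjacent  : ∀ (a : Fin m) {b : Fin m} → toℕ b ≡ suc (toℕ a) →
                T (adj G (vert a) (vert b))
open Path public

firstV : ∀ {n} {G : Graph n} k → Path G (suc (2 * k)) → Fin n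
firstV k P = vert P zero

lastV : ∀ {n} {G : Graph n} k → Path G (suc (2 * k)) → Fin n
lastV k P = vert P (fromℕ (2 * k))

-- Let H be the spanning subgraph of the edges of Ĥ that meet U.  Then
-- 2(e(U) + e(U,W)) = 2e(H) and 2e(U) = 2e(H[U]), so under either hypothesis
-- (in case (2) unless (1) already applies) some vertex set S, namely V or U,
-- has 2e(H[S]) > c|S| for c = 4κ + t − 2.  An Erdős–Gallai argument then gives
-- a path on c + 2 vertices in H: deleting a vertex of degree ≤ c/2 keeps this
-- density, and once all degrees exceed c/2 a path on at most c + 1 vertices
-- can be extended unless, by Pósa rotation, its vertex set carries a spanning
-- cycle with no edge leaving it, whose deletion keeps the density again.
-- Since c + 2 = Σ (4k'ᵢ + 1), cut the path into consecutive blocks of these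
-- sizes.  Every edge of H meets U, so no two consecutive vertices of a block
-- avoid U; hence a block of 4k + 1 vertices has positions p ≤ 2k and p + 2k
-- both in U, and the 2k + 1 vertices between them form the required path.

{-# OPTIONS --safe #-}

module Submission where

open import Defs hiding (sym)
open import Data.Bool using (Bool; true; false; T; _∧_; _∨_; not)
open import Data.Bool.Properties using (T-≡; T-∧; ∨-comm; ∧-comm; ∧-zeroʳ; ∧-identityʳ)
open import Data.Empty using (⊥; ⊥-elim)
open import Data.Fin using (Fin; zero; suc; toℕ; fromℕ<)
open import Data.Fin.Properties using (_≟_; any?; toℕ<n; toℕ-fromℕ<; toℕ-fromℕ; toℕ-injective)
open import Data.List using (List; []; _∷_; _++_; _∷ʳ_; _ʳ++_; length; map; tabulate; reverse)
open import Data.List.Properties using (map-tabulate; unfold-reverse; ʳ++-defn; ++-identityʳ)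
open import Data.List.Relation.Unary.Linked as Linked using (Linked; []; [-]; _∷_)
open import Data.Nat hiding (_≟_)
open import Data.Nat.ListAction using (sum)
open import Data.Nat.Properties hiding (_≟_)
open import Data.Nat.Properties using () renaming (_≟_ to _≟ℕ_)
open import Data.Nat.Tactic.RingSolver using (solve-∀)
open import Algebra.Properties.Semiring.Sum +-*-semiring
  using (sum-syntax; sum-cong-≗; ∑-distrib-+; ∑-comm; *-distribˡ-sum; sum-replicate-zero)
open import Data.Product using (Σ; ∃; ∃₂; _×_; _,_; proj₁; proj₂)
open import Data.Sum using (_⊎_; inj₁; inj₂)
open import Function using (_∘_; case_of_)
open import Function.Bundles using (module Equivalence)
open import Relation.Binary.Definitions using (tri<; tri≈; tri>)
open import Relation.Binary.PropositionalEquality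
open import Relation.Nullary using (¬_; Dec; does; yes; no)
open import Relation.Nullary.Decidable using (T?; _×-dec_)

open Equivalence using (to; from)

∑-mono-≤ : ∀ {n} {f g : Fin n → ℕ} → (∀ i → f i ≤ g i) →
           ∑[ i < n ] f i ≤ ∑[ i < n ] g i
∑-mono-≤ {zero}  _   = z≤n
∑-mono-≤ {suc n} f≤g = +-mono-≤ (f≤g zero) (∑-mono-≤ (f≤g ∘ suc))

∑-ones : ∀ n → ∑[ i < n ] 1 ≡ n
∑-ones zero    = refl
∑-ones (suc n) = cong suc (∑-ones n)

∑-≤-card : ∀ {n} {f : Fin n → ℕ} → (∀ i → f i ≤ 1) → ∑[ i < n ] f i ≤ n
∑-≤-card {n} f≤1 = ≤-trans (∑-mono-≤ f≤1) (≤-reflexive (∑-ones n))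

sum-tabulate : ∀ n (f : Fin n → ℕ) → sum (tabulate f) ≡ ∑[ i < n ] f i
sum-tabulate zero    f = refl
sum-tabulate (suc n) f = cong (f zero +_) (sum-tabulate n (f ∘ suc))

Σfin≡∑ : ∀ n (f : Fin n → ℕ) → Σfin n f ≡ ∑[ i < n ] f i
Σfin≡∑ n f = trans (cong sum (map-tabulate (λ i → i) f)) (sum-tabulate n f)

bit≤1 : ∀ b → bit b ≤ 1
bit≤1 true  = s≤s z≤n
bit≤1 false = z≤n

bit-T : ∀ {b} → T b → bit b ≡ 1
bit-T {true} _ = refl

bit-¬T : ∀ {b} → ¬ T b → bit b ≡ 0
bit-¬T {true}  ¬b = ⊥-elim (¬b _)
bit-¬T {false} _  = refl

δ : ∀ {n} → Fin n → Fin n → ℕ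
δ u v = bit (does (u ≟ v))

δ-refl : ∀ {n} (u : Fin n) → δ u u ≡ 1
δ-refl zero    = refl
δ-refl (suc u) = δ-refl u

∑-δ : ∀ {n} (x : Fin n) (h : Fin n → ℕ) → ∑[ u < n ] (δ u x * h u) ≡ h x
∑-δ {suc n} zero    h = trans (cong (h zero + 0 +_) (sum-replicate-zero n))
                              (trans (+-identityʳ _) (+-identityʳ _))
∑-δ {suc n} (suc x) h = ∑-δ x (h ∘ suc)

mult : ∀ {n} → List (Fin n) → Fin n → ℕ
mult []       v = 0
mult (x ∷ xs) v = δ v x + mult xs v

∑-mult-weighted : ∀ {n} (L : List (Fin n)) (h : Fin n → ℕ) →
                  ∑[ u < n ] (mult L u * h u) ≡ sum (map h L)
∑-mult-weighted {n} []      h = sum-replicate-zero n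
∑-mult-weighted {n} (x ∷ L) h = begin
  ∑[ u < n ] ((δ u x + mult L u) * h u)
    ≡⟨ sum-cong-≗ (λ u → *-distribʳ-+ (h u) (δ u x) (mult L u)) ⟩
  ∑[ u < n ] (δ u x * h u + mult L u * h u)
    ≡⟨ ∑-distrib-+ (λ u → δ u x * h u) (λ u → mult L u * h u) ⟩
  ∑[ u < n ] (δ u x * h u) + ∑[ u < n ] (mult L u * h u)
    ≡⟨ cong₂ _+_ (∑-δ x h) (∑-mult-weighted L h) ⟩
  h x + sum (map h L) ∎
  where open ≡-Reasoning

∑-mult : ∀ {n} (L : List (Fin n)) → ∑[ u < n ] mult L u ≡ length L
∑-mult {n} []      = sum-replicate-zero n
∑-mult {n} (x ∷ L) = begin
  ∑[ u < n ] (δ u x + mult L u)           ≡⟨ ∑-distrib-+ (λ u → δ u x) (λ u → mult L u) ⟩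
  ∑[ u < n ] δ u x + ∑[ u < n ] mult L u  ≡⟨ cong₂ _+_ ∑δ≡1 (∑-mult L) ⟩
  suc (length L)                          ∎
  where
  open ≡-Reasoning
  ∑δ≡1 : ∑[ u < n ] δ u x ≡ 1
  ∑δ≡1 = trans (sum-cong-≗ (λ u → sym (*-identityʳ (δ u x)))) (∑-δ x (λ _ → 1))

mult-++ : ∀ {n} (xs ys : List (Fin n)) v → mult (xs ++ ys) v ≡ mult xs v + mult ys v
mult-++ []       ys v = refl
mult-++ (x ∷ xs) ys v = trans (cong (δ v x +_) (mult-++ xs ys v)) (sym (+-assoc (δ v x) _ _))

mult-++-comm : ∀ {n} (xs ys : List (Fin n)) v → mult (xs ++ ys) v ≡ mult (ys ++ xs) v
mult-++-comm xs ys v = begin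
  mult (xs ++ ys) v       ≡⟨ mult-++ xs ys v ⟩
  mult xs v + mult ys v   ≡⟨ +-comm (mult xs v) (mult ys v) ⟩
  mult ys v + mult xs v   ≡⟨ mult-++ ys xs v ⟨
  mult (ys ++ xs) v       ∎
  where open ≡-Reasoning

mult-reverse : ∀ {n} (xs : List (Fin n)) v → mult (reverse xs) v ≡ mult xs v
mult-reverse []       v = refl
mult-reverse (x ∷ xs) v = begin
  mult (reverse (x ∷ xs)) v    ≡⟨ cong (λ L → mult L v) (unfold-reverse x xs) ⟩
  mult (reverse xs ∷ʳ x) v     ≡⟨ mult-++-comm (reverse xs) (x ∷ []) v ⟩
  δ v x + mult (reverse xs) v  ≡⟨ cong (δ v x +_) (mult-reverse xs v) ⟩
  mult (x ∷ xs) v              ∎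
  where open ≡-Reasoning

mult-ʳ++ : ∀ {n} (xs ys : List (Fin n)) v → mult (xs ʳ++ ys) v ≡ mult (xs ++ ys) v
mult-ʳ++ xs ys v = begin
  mult (xs ʳ++ ys) v              ≡⟨ cong (λ L → mult L v) (ʳ++-defn xs) ⟩
  mult (reverse xs ++ ys) v       ≡⟨ mult-++ (reverse xs) ys v ⟩
  mult (reverse xs) v + mult ys v ≡⟨ cong (_+ mult ys v) (mult-reverse xs v) ⟩
  mult xs v + mult ys v           ≡⟨ mult-++ xs ys v ⟨
  mult (xs ++ ys) v               ∎
  where open ≡-Reasoning

infix 4 _∈_
_∈_ : ∀ {n} → Fin n → List (Fin n) → Set
v ∈ L = 1 ≤ mult L v

∈-head : ∀ {n} (x : Fin n) xs → x ∈ x ∷ xs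
∈-head x xs rewrite δ-refl x = s≤s z≤n

∈-tail : ∀ {n} {v : Fin n} x xs → v ∈ xs → v ∈ x ∷ xs
∈-tail {v = v} x xs v∈ = ≤-trans v∈ (m≤n+m (mult xs v) (δ v x))

∈-split : ∀ {n} {v : Fin n} xs → v ∈ xs → ∃₂ λ ys zs → xs ≡ ys ++ v ∷ zs
∈-split {v = v} (x ∷ xs) v∈ with v ≟ x
... | yes refl = [] , xs , refl
... | no _     with ys , zs , refl ← ∈-split xs v∈ = x ∷ ys , zs , refl

length-≗ : ∀ {n} (xs ys : List (Fin n)) → mult xs ≗ mult ys → length xs ≡ length ys
length-≗ xs ys eq = trans (sym (∑-mult xs)) (trans (sum-cong-≗ eq) (∑-mult ys))

sum-map-≤ : ∀ {n} (xs : List (Fin n)) {h B} → (∀ x → x ∈ xs → h x ≤ B) →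
            sum (map h xs) ≤ length xs * B
sum-map-≤ []       _   = z≤n
sum-map-≤ (x ∷ xs) h≤B =
  +-mono-≤ (h≤B x (∈-head x xs)) (sum-map-≤ xs (λ y y∈ → h≤B y (∈-tail x xs y∈)))

sum-map-bit-≤ : ∀ {A : Set} (f : A → Bool) xs → sum (map (bit ∘ f) xs) ≤ length xs
sum-map-bit-≤ f []       = z≤n
sum-map-bit-≤ f (x ∷ xs) = +-mono-≤ (bit≤1 (f x)) (sum-map-bit-≤ f xs)

lastOf : ∀ {A : Set} → A → List A → A
lastOf x []       = x
lastOf x (y ∷ ys) = lastOf y ys

lastOf-++ : ∀ {A : Set} (x : A) xs y ys → lastOf x (xs ++ y ∷ ys) ≡ lastOf y ys
lastOf-++ x []       y ys = refl
lastOf-++ x (z ∷ xs) y ys = lastOf-++ z xs y ys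

∈-lastOf : ∀ {n} (x : Fin n) xs → lastOf x xs ∈ x ∷ xs
∈-lastOf x []       = ∈-head x []
∈-lastOf x (y ∷ xs) = ∈-tail x (y ∷ xs) (∈-lastOf y xs)

module _ {A : Set} {R : A → A → Set} where

  linked-++ : ∀ {x xs y ys} → Linked R (x ∷ xs) → R (lastOf x xs) y → Linked R (y ∷ ys) →
              Linked R (x ∷ xs ++ y ∷ ys)
  linked-++ [-]          r lys = r ∷ lys
  linked-++ (r′ ∷ lxs)   r lys = r′ ∷ linked-++ lxs r lys

  linked-++⁻ˡ : ∀ xs {ys} → Linked R (xs ++ ys) → Linked R xs
  linked-++⁻ˡ []           _         = []
  linked-++⁻ˡ (x ∷ [])     _         = [-]
  linked-++⁻ˡ (x ∷ y ∷ xs) (r ∷ l)   = r ∷ linked-++⁻ˡ (y ∷ xs) l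

  linked-++⁻ʳ : ∀ xs {ys} → Linked R (xs ++ ys) → Linked R ys
  linked-++⁻ʳ []           l       = l
  linked-++⁻ʳ (x ∷ xs)     l       = linked-++⁻ʳ xs (Linked.tail l)

  linked-rotate : ∀ x xs w ys → Linked R (x ∷ xs ++ w ∷ ys) → R (lastOf w ys) x →
                  Linked R (w ∷ ys ++ x ∷ xs)
  linked-rotate x xs w ys l r = linked-++ (linked-++⁻ʳ (x ∷ xs) l) r (linked-++⁻ˡ (x ∷ xs) l)

  linked-cycle-rotate : ∀ z zs xs w ys → z ∷ zs ≡ xs ++ w ∷ ys →
                        Linked R (z ∷ zs) → R (lastOf z zs) z → Linked R (w ∷ ys ++ xs)
  linked-cycle-rotate z zs []       w ys refl l r rewrite ++-identityʳ ys = l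
  linked-cycle-rotate z zs (x ∷ xs) w ys refl l r =
    linked-rotate x xs w ys l (subst (λ v → R v x) (lastOf-++ x xs w ys) r)

ʳ++-∷ : ∀ {A : Set} (x : A) xs y ys → Σ (List A) λ zs →
        (x ∷ xs) ʳ++ (y ∷ ys) ≡ lastOf x xs ∷ zs × lastOf (lastOf x xs) zs ≡ lastOf y ys
ʳ++-∷ x []       y ys = y ∷ ys , refl , refl
ʳ++-∷ x (z ∷ xs) y ys = ʳ++-∷ z xs x (y ∷ ys)

module _ {A : Set} {R : A → A → Set} (R-sym : ∀ {x y} → R x y → R y x) where

  linked-ʳ++ : ∀ {x xs ys} → Linked R (x ∷ xs) → Linked R (x ∷ ys) →
               Linked R ((x ∷ xs) ʳ++ ys)
  linked-ʳ++ [-]         lys = lys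
  linked-ʳ++ (r ∷ lxs)   lys = linked-ʳ++ lxs (R-sym r ∷ lys)

module _ {A : Set} (f g : A → Bool) where

  crossings : A → List A → ℕ
  crossings x []       = 0
  crossings x (y ∷ ys) = bit (g x) + bit (f y) + crossings y ys

  Crossing : A → List A → Set
  Crossing x xs = Σ (List A) λ X → Σ A λ y → Σ (List A) λ Y →
                  xs ≡ X ++ y ∷ Y × T (g (lastOf x X)) × T (f y)

  crossing-∷ : ∀ x y ys → Crossing y ys → Crossing x (y ∷ ys)
  crossing-∷ x y ys (X , z , Z , refl , gz , fz) = y ∷ X , z , Z , refl , gz , fz

  pigeonhole : ∀ x xs → length xs < crossings x xs → Crossing x xs
  pigeonhole x (y ∷ ys) h with g x in gx | f y in fy
  ... | true  | true  = [] , y , ys , refl , from T-≡ gx , from T-≡ fy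
  ... | true  | false = crossing-∷ x y ys (pigeonhole y ys (≤-pred h))
  ... | false | true  = crossing-∷ x y ys (pigeonhole y ys (≤-pred h))
  ... | false | false = crossing-∷ x y ys (pigeonhole y ys (≤-trans (n≤1+n _) h))

  crossings-≡ : ∀ x xs → crossings x xs + bit (f x) + bit (g (lastOf x xs)) ≡
                         sum (map (bit ∘ f) (x ∷ xs)) + sum (map (bit ∘ g) (x ∷ xs))
  crossings-≡ x []       = shuffle (bit (f x)) (bit (g x))
    where shuffle : ∀ a b → 0 + a + b ≡ a + 0 + (b + 0)
          shuffle = solve-∀
  crossings-≡ x (y ∷ ys) = begin
    bit (g x) + bit (f y) + crossings y ys + bit (f x) + bit (g (lastOf y ys))
      ≡⟨ shuffle (bit (g x)) (bit (f y)) (crossings y ys) (bit (f x)) (bit (g (lastOf y ys))) ⟩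
    bit (f x) + (bit (g x) + (crossings y ys + bit (f y) + bit (g (lastOf y ys))))
      ≡⟨ cong (λ s → bit (f x) + (bit (g x) + s)) (crossings-≡ y ys) ⟩
    bit (f x) + (bit (g x) + (sum (map (bit ∘ f) (y ∷ ys)) + sum (map (bit ∘ g) (y ∷ ys))))
      ≡⟨ shuffle′ (bit (f x)) (bit (g x)) (sum (map (bit ∘ f) (y ∷ ys)))
                  (sum (map (bit ∘ g) (y ∷ ys))) ⟩
    sum (map (bit ∘ f) (x ∷ y ∷ ys)) + sum (map (bit ∘ g) (x ∷ y ∷ ys)) ∎
    where
    open ≡-Reasoning
    shuffle : ∀ a b s d e → a + b + s + d + e ≡ d + (a + (s + b + e))
    shuffle = solve-∀
    shuffle′ : ∀ d a p q → d + (a + (p + q)) ≡ d + p + (a + q)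
    shuffle′ = solve-∀

module _ {n : ℕ} where

  𝟙 : (Fin n → Bool) → Fin n → ℕ
  𝟙 S v = bit (S v)

  size : (Fin n → Bool) → ℕ
  size S = ∑[ v < n ] 𝟙 S v

  Distinct : List (Fin n) → Set
  Distinct L = ∀ v → mult L v ≤ 1

  Within : (Fin n → Bool) → List (Fin n) → Set
  Within S L = ∀ v → v ∈ L → T (S v)

  infixl 6 _∖_
  _∖_ : (Fin n → Bool) → List (Fin n) → Fin n → Bool
  (S ∖ L) v = S v ∧ (mult L v ≡ᵇ 0)

  𝟙-split : ∀ S L → Distinct L → Within S L → ∀ v → 𝟙 S v ≡ 𝟙 (S ∖ L) v + mult L v
  𝟙-split S L dL wL v with S v in Sv | mult L v in m | dL v
  ... | true  | zero        | _ = refl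
  ... | true  | suc zero    | _ = refl
  ... | true  | suc (suc _) | s≤s ()
  ... | false | zero        | _ = refl
  ... | false | suc _       | _ = ⊥-elim (subst T Sv (wL v (subst (1 ≤_) (sym m) (s≤s z≤n))))

  size-∖ : ∀ S L → Distinct L → Within S L → size S ≡ size (S ∖ L) + length L
  size-∖ S L dL wL = begin
    size S                                          ≡⟨ sum-cong-≗ (𝟙-split S L dL wL) ⟩
    ∑[ v < n ] (𝟙 (S ∖ L) v + mult L v)             ≡⟨ ∑-distrib-+ (𝟙 (S ∖ L)) (mult L) ⟩
    size (S ∖ L) + ∑[ v < n ] mult L v              ≡⟨ cong (size (S ∖ L) +_) (∑-mult L) ⟩
    size (S ∖ L) + length L                         ∎
    where open ≡-Reasoning

  𝟙-∖-≤ : ∀ S L v → 𝟙 (S ∖ L) v ≤ 𝟙 S v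
  𝟙-∖-≤ S L v with S v
  ... | true  = bit≤1 _
  ... | false = z≤n

  ∷-distinct : ∀ {y L} → Distinct L → mult L y ≡ 0 → Distinct (y ∷ L)
  ∷-distinct {y} {L} dL fresh v with v ≟ y
  ... | yes refl rewrite fresh = s≤s z≤n
  ... | no _     = dL v

  distinct-head : ∀ (x : Fin n) xs → Distinct (x ∷ xs) → ¬ x ∈ xs
  distinct-head x xs dx x∈ with dx x
  ... | dx≤1 rewrite δ-refl x = <⇒≱ (s≤s x∈) dx≤1

  distinct-tail : ∀ (x : Fin n) xs → Distinct (x ∷ xs) → Distinct xs
  distinct-tail x xs dx v = ≤-trans (m≤n+m (mult xs v) (δ v x)) (dx v)

  ∷-within : ∀ {S y L} → Within S L → T (S y) → Within S (y ∷ L)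
  ∷-within {y = y} wL Sy v v∈ with v ≟ y
  ... | yes refl = Sy
  ... | no _     = wL v v∈

<ᵇ-one-way : ∀ {n} (u v : Fin n) → u ≢ v →
             bit (toℕ u <ᵇ toℕ v) + bit (toℕ v <ᵇ toℕ u) ≡ 1
<ᵇ-one-way u v u≢v with <-cmp (toℕ u) (toℕ v)
... | tri< u<v _ v≮u = cong₂ _+_ (bit-T (<⇒<ᵇ u<v)) (bit-¬T (v≮u ∘ <ᵇ⇒< _ _))
... | tri≈ _ u≡v _   = ⊥-elim (u≢v (toℕ-injective u≡v))
... | tri> u≮v _ v<u = cong₂ _+_ (bit-¬T (u≮v ∘ <ᵇ⇒< _ _)) (bit-T (<⇒<ᵇ v<u))

module EdgeCounting {n : ℕ} (H : Graph n) where

  infix 4 _~_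
  _~_ : Fin n → Fin n → Set
  u ~ v = T (adj H u v)

  ~-sym : ∀ {u v} → u ~ v → v ~ u
  ~-sym {u} {v} = subst T (Graph.sym H u v)

  nbr : (Fin n → ℕ) → Fin n → ℕ
  nbr g u = ∑[ v < n ] (g v * bit (adj H u v))

  deg : (Fin n → Bool) → Fin n → ℕ
  deg S = nbr (𝟙 S)

  -- Summed over ordered adjacent pairs: twiceEdges S = 2e(H[S]), and for a set L
  -- inside S, pairs (mult L) (𝟙 (S ∖ L)) = e(L, S ∖ L).
  pairs : (Fin n → ℕ) → (Fin n → ℕ) → ℕ
  pairs f g = ∑[ u < n ] (f u * nbr g u)

  twiceEdges : (Fin n → Bool) → ℕ
  twiceEdges S = pairs (𝟙 S) (𝟙 S)

  pairs-cong : ∀ {f f′ g g′} → f ≗ f′ → g ≗ g′ → pairs f g ≡ pairs f′ g′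
  pairs-cong f≗f′ g≗g′ =
    sum-cong-≗ λ u → cong₂ _*_ (f≗f′ u) (sum-cong-≗ λ v → cong (_* _) (g≗g′ v))

  pairs-+ˡ : ∀ f₁ f₂ g → pairs (λ v → f₁ v + f₂ v) g ≡ pairs f₁ g + pairs f₂ g
  pairs-+ˡ f₁ f₂ g =
    trans (sum-cong-≗ λ u → *-distribʳ-+ (nbr g u) (f₁ u) (f₂ u))
          (∑-distrib-+ (λ u → f₁ u * nbr g u) (λ u → f₂ u * nbr g u))

  nbr-+ : ∀ g₁ g₂ u → nbr (λ v → g₁ v + g₂ v) u ≡ nbr g₁ u + nbr g₂ u
  nbr-+ g₁ g₂ u =
    trans (sum-cong-≗ λ v → *-distribʳ-+ (bit (adj H u v)) (g₁ v) (g₂ v))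
          (∑-distrib-+ (λ v → g₁ v * bit (adj H u v)) (λ v → g₂ v * bit (adj H u v)))

  nbr-mono : ∀ {g g′} → (∀ v → g v ≤ g′ v) → ∀ u → nbr g u ≤ nbr g′ u
  nbr-mono g≤g′ u = ∑-mono-≤ λ v → *-monoˡ-≤ (bit (adj H u v)) (g≤g′ v)

  pairs-+ʳ : ∀ f g₁ g₂ → pairs f (λ v → g₁ v + g₂ v) ≡ pairs f g₁ + pairs f g₂
  pairs-+ʳ f g₁ g₂ = trans
    (sum-cong-≗ λ u → trans (cong (f u *_) (nbr-+ g₁ g₂ u)) (*-distribˡ-+ (f u) _ _))
    (∑-distrib-+ (λ u → f u * nbr g₁ u) (λ u → f u * nbr g₂ u))

  pairs-comm : ∀ f g → pairs f g ≡ pairs g f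
  pairs-comm f g = begin
    ∑[ u < n ] (f u * ∑[ v < n ] (g v * a u v))
      ≡⟨ sum-cong-≗ (λ u → *-distribˡ-sum (f u) (λ v → g v * a u v)) ⟩
    ∑[ u < n ] ∑[ v < n ] (f u * (g v * a u v))
      ≡⟨ ∑-comm (λ u v → f u * (g v * a u v)) ⟩
    ∑[ v < n ] ∑[ u < n ] (f u * (g v * a u v))
      ≡⟨ sum-cong-≗ (λ v → sum-cong-≗ (λ u → swap u v)) ⟩
    ∑[ v < n ] ∑[ u < n ] (g v * (f u * a v u))
      ≡⟨ sum-cong-≗ (λ v → *-distribˡ-sum (g v) (λ u → f u * a v u)) ⟨
    ∑[ v < n ] (g v * ∑[ u < n ] (f u * a v u)) ∎
    where
    open ≡-Reasoning
    a : Fin n → Fin n → ℕ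
    a u v = bit (adj H u v)
    shuffle : ∀ x y z → x * (y * z) ≡ y * (x * z)
    shuffle = solve-∀
    swap : ∀ u v → f u * (g v * a u v) ≡ g v * (f u * a v u)
    swap u v = trans (shuffle (f u) (g v) (a u v)) (cong (λ b → g v * (f u * bit b)) (Graph.sym H u v))

  pairs-square : ∀ f g → pairs (λ v → f v + g v) (λ v → f v + g v) ≡
                         pairs f f + 2 * pairs g f + pairs g g
  pairs-square f g = begin
    pairs (λ v → f v + g v) (λ v → f v + g v)
      ≡⟨ pairs-+ˡ f g (λ v → f v + g v) ⟩
    pairs f (λ v → f v + g v) + pairs g (λ v → f v + g v)
      ≡⟨ cong₂ _+_ (pairs-+ʳ f f g) (pairs-+ʳ g f g) ⟩
    (pairs f f + pairs f g) + (pairs g f + pairs g g)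
      ≡⟨ cong (λ p → (pairs f f + p) + (pairs g f + pairs g g)) (pairs-comm f g) ⟩
    (pairs f f + pairs g f) + (pairs g f + pairs g g)
      ≡⟨ collect (pairs f f) (pairs g f) (pairs g g) ⟩
    pairs f f + 2 * pairs g f + pairs g g ∎
    where
    open ≡-Reasoning
    collect : ∀ a b c → (a + b) + (b + c) ≡ a + 2 * b + c
    collect = solve-∀

  pairs-list : ∀ L g → pairs (mult L) g ≡ sum (map (nbr g) L)
  pairs-list L g = ∑-mult-weighted L (nbr g)

  nbr-list : ∀ L u → nbr (mult L) u ≡ sum (map (bit ∘ adj H u) L)
  nbr-list L u = ∑-mult-weighted L (bit ∘ adj H u)

  nbr-list-< : ∀ {u} L → u ∈ L → sum (map (bit ∘ adj H u) L) < length L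
  nbr-list-< {u} (x ∷ L) u∈ with u ≟ x
  ... | yes refl rewrite Graph.irrefl H u = s≤s (sum-map-bit-≤ (adj H u) L)
  ... | no _     = ≤-trans (≤-reflexive (sym (+-suc (bit (adj H u x)) _)))
                           (+-mono-≤ (bit≤1 (adj H u x)) (nbr-list-< L u∈))

  pairs-self-≤ : ∀ L → pairs (mult L) (mult L) ≤ length L * (length L ∸ 1)
  pairs-self-≤ L = begin
    pairs (mult L) (mult L)           ≡⟨ pairs-list L (mult L) ⟩
    sum (map (nbr (mult L)) L)        ≤⟨ sum-map-≤ L (λ u u∈ → nbr≤ u u∈) ⟩
    length L * (length L ∸ 1)         ∎
    where
    open ≤-Reasoning
    nbr≤ : ∀ u → u ∈ L → nbr (mult L) u ≤ length L ∸ 1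
    nbr≤ u u∈ = begin
      nbr (mult L) u                               ≡⟨ nbr-list L u ⟩
      sum (map (bit ∘ adj H u) L)                  ≤⟨ ∸-monoˡ-≤ 1 (nbr-list-< L u∈) ⟩
      length L ∸ 1                                 ∎

  twiceEdges-∖ : ∀ S L → Distinct L → Within S L →
                 twiceEdges S ≡
                 twiceEdges (S ∖ L) + 2 * pairs (mult L) (𝟙 (S ∖ L)) + pairs (mult L) (mult L)
  twiceEdges-∖ S L dL wL = trans (pairs-cong (𝟙-split S L dL wL) (𝟙-split S L dL wL))
                                     (pairs-square (𝟙 (S ∖ L)) (mult L))

  twice-countEdges : ∀ P → (∀ u v → P u v ≡ P v u) →
                     2 * countEdges H P ≡ ∑[ u < n ] ∑[ v < n ] bit (adj H u v ∧ P u v)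
  twice-countEdges P P-sym = begin
    2 * countEdges H P                  ≡⟨ cong (2 *_) count≡ ⟩
    C + (C + 0)                         ≡⟨ cong (C +_) (trans (+-identityʳ C) C≡C′) ⟩
    C + C′                              ≡⟨ both-orders ⟨
    ∑[ u < n ] ∑[ v < n ] (bit (lt u v ∧ X u v) + bit (lt v u ∧ X u v))
                                        ≡⟨ sum-cong-≗ (λ u → sum-cong-≗ (one-order u)) ⟩
    ∑[ u < n ] ∑[ v < n ] bit (X u v)   ∎
    where
    open ≡-Reasoning
    X : Fin n → Fin n → Bool
    X u v = adj H u v ∧ P u v
    lt : Fin n → Fin n → Bool
    lt u v = toℕ u <ᵇ toℕ v
    C C′ : ℕ
    C  = ∑[ u < n ] ∑[ v < n ] bit (lt u v ∧ X u v)
    C′ = ∑[ u < n ] ∑[ v < n ] bit (lt v u ∧ X u v)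
    count≡ : countEdges H P ≡ C
    count≡ = trans (Σfin≡∑ n _) (sum-cong-≗ λ u → Σfin≡∑ n (λ v → bit (lt u v ∧ X u v)))
    both-orders : ∑[ u < n ] ∑[ v < n ] (bit (lt u v ∧ X u v) + bit (lt v u ∧ X u v)) ≡ C + C′
    both-orders = trans (sum-cong-≗ λ u → ∑-distrib-+ (λ v → bit (lt u v ∧ X u v))
                                                      (λ v → bit (lt v u ∧ X u v)))
                        (∑-distrib-+ (λ u → ∑[ v < n ] bit (lt u v ∧ X u v))
                                     (λ u → ∑[ v < n ] bit (lt v u ∧ X u v)))
    C≡C′ : C ≡ C′
    C≡C′ = trans (∑-comm (λ u v → bit (lt u v ∧ X u v)))
                 (sum-cong-≗ λ u → sum-cong-≗ λ v →
                   cong (λ b → bit (lt v u ∧ b)) (cong₂ _∧_ (Graph.sym H v u) (P-sym v u)))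
    one-order : ∀ u v → bit (lt u v ∧ X u v) + bit (lt v u ∧ X u v) ≡ bit (X u v)
    one-order u v with X u v in Xuv
    ... | false rewrite ∧-zeroʳ (lt u v) | ∧-zeroʳ (lt v u) = refl
    ... | true  rewrite ∧-identityʳ (lt u v) | ∧-identityʳ (lt v u) = <ᵇ-one-way u v u≢v
      where
      u≢v : u ≢ v
      u≢v refl = case trans (sym Xuv) (cong (_∧ P u u) (Graph.irrefl H u)) of λ ()

  Dense : ℕ → (Fin n → Bool) → Set
  Dense c S = c * size S < twiceEdges S

  dense-∖ : ∀ {c} S L → Distinct L → Within S L →
            2 * pairs (mult L) (𝟙 (S ∖ L)) + pairs (mult L) (mult L) ≤ c * length L →
            Dense c S → Dense c (S ∖ L)
  dense-∖ {c} S L dL wL cut≤ dense =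
    +-cancelʳ-< (c * length L) (c * size (S ∖ L)) (twiceEdges (S ∖ L)) (begin-strict
      c * size (S ∖ L) + c * length L
        ≡⟨ *-distribˡ-+ c (size (S ∖ L)) (length L) ⟨
      c * (size (S ∖ L) + length L)
        ≡⟨ cong (c *_) (size-∖ S L dL wL) ⟨
      c * size S
        <⟨ dense ⟩
      twiceEdges S
        ≡⟨ trans (twiceEdges-∖ S L dL wL) (+-assoc (twiceEdges (S ∖ L)) _ _) ⟩
      twiceEdges (S ∖ L) + (2 * pairs (mult L) (𝟙 (S ∖ L)) + pairs (mult L) (mult L))
        ≤⟨ +-monoʳ-≤ (twiceEdges (S ∖ L)) cut≤ ⟩
      twiceEdges (S ∖ L) + c * length L ∎)
    where open ≤-Reasoning

  deg-≤ : ∀ S u → deg S u ≤ n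
  deg-≤ S u = ∑-≤-card λ v → bits≤1 (S v) (adj H u v)
    where
    bits≤1 : ∀ a b → bit a * bit b ≤ 1
    bits≤1 true  b = ≤-trans (≤-reflexive (+-identityʳ (bit b))) (bit≤1 b)
    bits≤1 false b = z≤n

  twiceEdges-≤ : ∀ S → twiceEdges S ≤ n * size S
  twiceEdges-≤ S = begin
    ∑[ u < n ] (𝟙 S u * deg S u)   ≤⟨ ∑-mono-≤ (λ u → *-monoʳ-≤ (𝟙 S u) (deg-≤ S u)) ⟩
    ∑[ u < n ] (𝟙 S u * n)         ≡⟨ sum-cong-≗ (λ u → *-comm (𝟙 S u) n) ⟩
    ∑[ u < n ] (n * 𝟙 S u)         ≡⟨ *-distribˡ-sum n (𝟙 S) ⟨
    n * size S                     ∎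
    where open ≤-Reasoning

  size≡0⇒¬dense : ∀ {c} S → size S ≡ 0 → ¬ Dense c S
  size≡0⇒¬dense {c} S size≡0 dense = <⇒≱ dense (begin
    twiceEdges S   ≤⟨ twiceEdges-≤ S ⟩
    n * size S     ≡⟨ cong (n *_) size≡0 ⟩
    n * 0          ≡⟨ *-zeroʳ n ⟩
    0              ≡⟨ *-zeroʳ c ⟨
    c * 0          ≡⟨ cong (c *_) size≡0 ⟨
    c * size S     ∎)
    where open ≤-Reasoning

  dense⇒nonempty : ∀ {c} S → Dense c S → ∃ λ v → T (S v)
  dense⇒nonempty {c} S dense with any? (λ v → T? (S v))
  ... | yes v∈S = v∈S
  ... | no  S≡∅ = ⊥-elim (size≡0⇒¬dense {c} S size≡0 dense)
    where
    𝟙≡0 : ∀ v → 𝟙 S v ≡ 0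
    𝟙≡0 v with S v in Sv
    ... | true  = ⊥-elim (S≡∅ (v , from T-≡ Sv))
    ... | false = refl
    size≡0 : size S ≡ 0
    size≡0 = trans (sum-cong-≗ 𝟙≡0) (sum-replicate-zero n)

<-sum-of-halves : ∀ {a b c} → c < 2 * a → c < 2 * b → c < a + b
<-sum-of-halves {a} {b} {c} c<2a c<2b = *-cancelˡ-≤ 2 (begin
  2 * suc c        ≡⟨ double (suc c) ⟩
  suc c + suc c    ≤⟨ +-mono-≤ c<2a c<2b ⟩
  2 * a + 2 * b    ≡⟨ *-distribˡ-+ 2 a b ⟨
  2 * (a + b)      ∎)
  where
  open ≤-Reasoning
  double : ∀ x → 2 * x ≡ x + x
  double = solve-∀

module LongPaths {n : ℕ} (H : Graph n) (c : ℕ) where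
  open EdgeCounting H

  record PathIn (S : Fin n → Bool) : Set where
    constructor path
    field
      start    : Fin n
      rest     : List (Fin n)
      linked   : Linked _~_ (start ∷ rest)
      distinct : Distinct (start ∷ rest)
      within   : Within S (start ∷ rest)

    vertices : List (Fin n)
    vertices = start ∷ rest

    end : Fin n
    end = lastOf start rest
  open PathIn

  Longer : ∀ {S} → PathIn S → Set
  Longer {S} P = Σ (PathIn S) λ P′ → length (vertices P′) ≡ suc (length (vertices P))

  Exit : (Fin n → Bool) → List (Fin n) → Fin n → Fin n → Set
  Exit S L w y = T (S y) × mult L y ≡ 0 × w ~ y

  exit? : ∀ S L w → Dec (∃ (Exit S L w))
  exit? S L w = any? λ y → T? (S y) ×-dec mult L y ≟ℕ 0 ×-dec T? (adj H w y)

  Stuck : (Fin n → Bool) → List (Fin n) → Fin n → Set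
  Stuck S L w = ¬ ∃ (Exit S L w)

  stuck⇒nbr≡0 : ∀ {S L w} → Stuck S L w → nbr (𝟙 (S ∖ L)) w ≡ 0
  stuck⇒nbr≡0 {S} {L} {w} stuck = trans (sum-cong-≗ term≡0) (sum-replicate-zero n)
    where
    term≡0 : ∀ u → 𝟙 (S ∖ L) u * bit (adj H w u) ≡ 0
    term≡0 u with S u in Su | mult L u in m | adj H w u in a
    ... | true  | zero  | true  = ⊥-elim (stuck (u , from T-≡ Su , m , from T-≡ a))
    ... | true  | zero  | false = refl
    ... | true  | suc _ | _     = refl
    ... | false | _     | _     = refl

  stuck⇒deg≡ : ∀ {S L w} → Distinct L → Within S L → Stuck S L w → deg S w ≡ nbr (mult L) w
  stuck⇒deg≡ {S} {L} {w} dL wL stuck = begin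
    nbr (𝟙 S) w
      ≡⟨ sum-cong-≗ (λ v → cong (_* bit (adj H w v)) (𝟙-split S L dL wL v)) ⟩
    nbr (λ v → 𝟙 (S ∖ L) v + mult L v) w
      ≡⟨ nbr-+ (𝟙 (S ∖ L)) (mult L) w ⟩
    nbr (𝟙 (S ∖ L)) w + nbr (mult L) w
      ≡⟨ cong (_+ nbr (mult L) w) (stuck⇒nbr≡0 {S} {L} stuck) ⟩
    nbr (mult L) w ∎
    where open ≡-Reasoning

  SpanningCycle : List (Fin n) → Set
  SpanningCycle L = Σ (Fin n) λ z → Σ (List (Fin n)) λ zs →
                    Linked _~_ (z ∷ zs) × lastOf z zs ~ z × mult (z ∷ zs) ≗ mult L

  -- Pósa rotation: from h ~ y and end ~ x, where x is the vertex before y,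
  -- the cycle is x … h y … end x.
  chords⇒cycle : ∀ h X y Y → Linked _~_ (h ∷ X ++ y ∷ Y) → h ~ y → lastOf y Y ~ lastOf h X →
                 SpanningCycle (h ∷ X ++ y ∷ Y)
  chords⇒cycle h X y Y l h~y end~ with ʳ++-∷ h X y Y
  ... | zs , eq , last≡ =
    lastOf h X , zs ,
    subst (Linked _~_) eq
      (linked-ʳ++ ~-sym (linked-++⁻ˡ (h ∷ X) l) (h~y ∷ linked-++⁻ʳ (h ∷ X) l)) ,
    subst (_~ lastOf h X) (sym last≡) end~ ,
    λ v → trans (cong (λ L → mult L v) (sym eq)) (mult-ʳ++ (h ∷ X) (y ∷ Y) v)

  MinDeg : (Fin n → Bool) → Set
  MinDeg S = ∀ v → T (S v) → c < 2 * deg S v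

  stuckEnds⇒crossings : ∀ {S} → MinDeg S → (P : PathIn S) → length (vertices P) ≤ suc c →
                        Stuck S (vertices P) (start P) → Stuck S (vertices P) (end P) →
                        length (rest P) < crossings (adj H (start P)) (adj H (end P)) (start P) (rest P)
  stuckEnds⇒crossings {S} minDeg P@(path h t _ dP wP) short stuckₛ stuckₑ = begin-strict
    length t
      ≤⟨ ≤-pred short ⟩
    c
      <⟨ <-sum-of-halves {deg S h} {deg S e} (minDeg h (wP h (∈-head h t)))
                                             (minDeg e (wP e (∈-lastOf h t))) ⟩
    deg S h + deg S e
      ≡⟨ cong₂ _+_ (degOnPath stuckₛ) (degOnPath stuckₑ) ⟩
    sum (map (bit ∘ adj H h) L) + sum (map (bit ∘ adj H e) L)
      ≡⟨ crossings-≡ (adj H h) (adj H e) h t ⟨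
    crossings (adj H h) (adj H e) h t + bit (adj H h h) + bit (adj H e e)
      ≡⟨ cong₂ (λ a b → crossings (adj H h) (adj H e) h t + bit a + bit b)
               (Graph.irrefl H h) (Graph.irrefl H e) ⟩
    crossings (adj H h) (adj H e) h t + 0 + 0
      ≡⟨ trans (+-identityʳ _) (+-identityʳ _) ⟩
    crossings (adj H h) (adj H e) h t ∎
    where
    open ≤-Reasoning
    L = h ∷ t
    e = end P
    degOnPath : ∀ {w} → Stuck S L w → deg S w ≡ sum (map (bit ∘ adj H w) L)
    degOnPath {w} stuck = trans (stuck⇒deg≡ {S} {L} dP wP stuck) (nbr-list L w)

  stuckEnds⇒cycle : ∀ {S} → MinDeg S → (P : PathIn S) → length (vertices P) ≤ suc c →
                    Stuck S (vertices P) (start P) → Stuck S (vertices P) (end P) →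
                    SpanningCycle (vertices P)
  stuckEnds⇒cycle minDeg P@(path h t l _ _) short stuckₛ stuckₑ
    with pigeonhole (adj H h) (adj H (end P)) h t (stuckEnds⇒crossings minDeg P short stuckₛ stuckₑ)
  ... | X , y , Y , refl , end~ , h~y =
    chords⇒cycle h X y Y l h~y (subst (_~ lastOf h X) (lastOf-++ h X y Y) end~)

  extend : ∀ {S} (P : PathIn S) {y} → T (S y) → mult (vertices P) y ≡ 0 →
           ∀ z zs → Linked _~_ (z ∷ zs) → mult (z ∷ zs) ≗ mult (y ∷ vertices P) → Longer P
  extend P {y} Sy fresh z zs l same =
    path z zs l (λ v → subst (_≤ 1) (sym (same v)) (∷-distinct {L = vertices P} (distinct P) fresh v))
                (λ v v∈ → ∷-within {L = vertices P} (within P) Sy v (subst (1 ≤_) (same v) v∈)) ,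
    length-≗ (z ∷ zs) (y ∷ vertices P) same

  Closed : (Fin n → Bool) → List (Fin n) → Set
  Closed S L = ∀ w → w ∈ L → Stuck S L w

  data Step {S} (P : PathIn S) : Set where
    longer : Longer P → Step P
    closed : Closed S (vertices P) → Step P

  cycle⇒step : ∀ {S} (P : PathIn S) → SpanningCycle (vertices P) → Step P
  cycle⇒step {S} P (z , zs , l , closing , same)
    with any? (λ w → 1 ≤? mult (vertices P) w ×-dec exit? S (vertices P) w)
  ... | no none = closed λ w w∈ exit → none (w , w∈ , exit)
  ... | yes (w , w∈ , y , Sy , fresh , w~y)
    with xs , ys , split ← ∈-split (z ∷ zs) (subst (1 ≤_) (sym (same w)) w∈) =
    longer (extend P Sy fresh y (w ∷ ys ++ xs)
             (~-sym w~y ∷ linked-cycle-rotate z zs xs w ys split l closing)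
             (λ v → cong (δ v y +_) (begin
               mult (w ∷ ys ++ xs) v   ≡⟨ mult-++-comm (w ∷ ys) xs v ⟩
               mult (xs ++ w ∷ ys) v   ≡⟨ cong (λ L → mult L v) split ⟨
               mult (z ∷ zs) v         ≡⟨ same v ⟩
               mult (vertices P) v     ∎)))
    where open ≡-Reasoning

  extendOrClose : ∀ {S} → MinDeg S → (P : PathIn S) → length (vertices P) ≤ suc c → Step P
  extendOrClose {S} minDeg P short with exit? S (vertices P) (start P) | exit? S (vertices P) (end P)
  ... | yes (y , Sy , fresh , s~y) | _ =
    longer (extend P Sy fresh y (vertices P) (~-sym s~y ∷ linked P) (λ _ → refl))
  ... | no _ | yes (y , Sy , fresh , e~y) =
    longer (extend P Sy fresh (start P) (rest P ++ y ∷ []) (linked-++ (linked P) e~y [-])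
                   (mult-++-comm (vertices P) (y ∷ [])))
  ... | no stuckₛ | no stuckₑ = cycle⇒step P (stuckEnds⇒cycle minDeg P short stuckₛ stuckₑ)

  singleton : ∀ {S v} → T (S v) → PathIn S
  singleton {v = v} Sv =
    path v [] [-] (∷-distinct {L = []} (λ _ → z≤n) refl) (∷-within {L = []} (λ _ ()) Sv)

  LongPath : Set
  LongPath = Σ (List (Fin n)) λ L → Linked _~_ L × Distinct L × suc (suc c) ≤ length L

  data Explored (S : Fin n → Bool) : Set where
    found  : LongPath → Explored S
    closed : (P : PathIn S) → length (vertices P) ≤ suc c → Closed S (vertices P) → Explored S

  explore : ∀ {S} → MinDeg S → ∀ F (P : PathIn S) → suc (suc c) ≤ F + length (vertices P) →
            Explored S
  explore minDeg F P enough with suc (suc c) ≤? length (vertices P)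
  ... | yes long = found (vertices P , linked P , distinct P , long)
  explore minDeg zero    P enough | no short = ⊥-elim (short enough)
  explore minDeg (suc F) P enough | no short with extendOrClose minDeg P (≤-pred (≰⇒> short))
  ... | longer (P′ , grown) =
    explore minDeg F P′ (subst (λ m → suc (suc c) ≤ F + m) (sym grown)
                               (subst (suc (suc c) ≤_) (sym (+-suc F _)) enough))
  ... | closed stuck = closed P (≤-pred (≰⇒> short)) stuck

  size-∖-≤ : ∀ {N S} (P : PathIn S) → size S ≤ suc N → size (S ∖ vertices P) ≤ N
  size-∖-≤ {N} {S} P size≤ = ≤-trans (m≤m+n _ (length (rest P))) (≤-pred (begin
    suc (size (S ∖ vertices P) + length (rest P))   ≡⟨ +-suc _ (length (rest P)) ⟨
    size (S ∖ vertices P) + length (vertices P)     ≡⟨ size-∖ S (vertices P) (distinct P) (within P) ⟨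
    size S                                          ≤⟨ size≤ ⟩
    suc N                                           ∎))
    where open ≤-Reasoning

  dense-∖-closed : ∀ {S} (P : PathIn S) → length (vertices P) ≤ suc c → Closed S (vertices P) →
                   Dense c S → Dense c (S ∖ vertices P)
  dense-∖-closed {S} P short stuck = dense-∖ {c} S L (distinct P) (within P) (begin
    2 * pairs (mult L) (𝟙 (S ∖ L)) + pairs (mult L) (mult L)
      ≤⟨ +-mono-≤ (*-monoʳ-≤ 2 noCut) (pairs-self-≤ L) ⟩
    2 * (length L * 0) + length L * (length L ∸ 1)
      ≡⟨ cong (λ x → 2 * x + length L * (length L ∸ 1)) (*-zeroʳ (length L)) ⟩
    length L * (length L ∸ 1)
      ≤⟨ *-monoʳ-≤ (length L) (∸-monoˡ-≤ 1 short) ⟩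
    length L * c
      ≡⟨ *-comm (length L) c ⟩
    c * length L ∎)
    where
    open ≤-Reasoning
    L = vertices P
    noCut : pairs (mult L) (𝟙 (S ∖ L)) ≤ length L * 0
    noCut = subst (_≤ length L * 0) (sym (pairs-list L (𝟙 (S ∖ L))))
              (sum-map-≤ L λ w w∈ → ≤-reflexive (stuck⇒nbr≡0 {S} {L} (stuck w w∈)))

  dense-∖-lowDeg : ∀ {S v} (Sv : T (S v)) → 2 * deg S v ≤ c → Dense c S → Dense c (S ∖ (v ∷ []))
  dense-∖-lowDeg {S} {v} Sv low =
    dense-∖ {c} S L (distinct (singleton {S} Sv)) (within (singleton {S} Sv)) (begin
    2 * pairs (mult L) (𝟙 (S ∖ L)) + pairs (mult L) (mult L)
      ≤⟨ +-mono-≤ (*-monoʳ-≤ 2 cut≤deg) (pairs-self-≤ L) ⟩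
    2 * deg S v + 0
      ≡⟨ +-identityʳ _ ⟩
    2 * deg S v
      ≤⟨ low ⟩
    c
      ≡⟨ *-identityʳ c ⟨
    c * 1 ∎)
    where
    open ≤-Reasoning
    L = v ∷ []
    cut≤deg : pairs (mult L) (𝟙 (S ∖ L)) ≤ deg S v
    cut≤deg = begin
      pairs (mult L) (𝟙 (S ∖ L))   ≡⟨ pairs-list L (𝟙 (S ∖ L)) ⟩
      nbr (𝟙 (S ∖ L)) v + 0        ≡⟨ +-identityʳ _ ⟩
      nbr (𝟙 (S ∖ L)) v            ≤⟨ nbr-mono (𝟙-∖-≤ S L) v ⟩
      deg S v                      ∎

  lowDegree-or-minDeg : ∀ S → (∃ λ v → T (S v) × 2 * deg S v ≤ c) ⊎ MinDeg S
  lowDegree-or-minDeg S with any? (λ v → T? (S v) ×-dec 2 * deg S v ≤? c)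
  ... | yes low  = inj₁ low
  ... | no noLow = inj₂ λ v Sv → ≰⇒> λ low → noLow (v , Sv , low)

  dense⇒longPath′ : ∀ N S → size S ≤ N → Dense c S → LongPath
  dense⇒longPath′ zero    S size≤0 dense = ⊥-elim (size≡0⇒¬dense {c} S (n≤0⇒n≡0 size≤0) dense)
  dense⇒longPath′ (suc N) S size≤ dense with lowDegree-or-minDeg S
  ... | inj₁ (v , Sv , low) =
    dense⇒longPath′ N (S ∖ (v ∷ [])) (size-∖-≤ (singleton {S} Sv) size≤)
                    (dense-∖-lowDeg {S} Sv low dense)
  ... | inj₂ minDeg with v , Sv ← dense⇒nonempty {c} S dense
                    with explore minDeg (suc (suc c)) (singleton {S} Sv) (m≤m+n _ _)
  ...   | found long = long
  ...   | closed P short stuck =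
    dense⇒longPath′ N (S ∖ vertices P) (size-∖-≤ P size≤) (dense-∖-closed P short stuck dense)

  dense⇒longPath : ∀ S → Dense c S → LongPath
  dense⇒longPath S = dense⇒longPath′ (size S) S ≤-refl

nth : ∀ {A : Set} → A → List A → ℕ → A
nth d []       i       = d
nth d (x ∷ xs) zero    = x
nth d (x ∷ xs) (suc i) = nth d xs i

nth-linked : ∀ {A : Set} {R : A → A → Set} (d : A) {xs} i → Linked R xs → suc i < length xs →
             R (nth d xs i) (nth d xs (suc i))
nth-linked d zero    [-]     (s≤s ())
nth-linked d (suc i) [-]     (s≤s ())
nth-linked d zero    (r ∷ _) _         = r
nth-linked d (suc i) (_ ∷ l) (s≤s i<) = nth-linked d i l i<

nth-∈ : ∀ {n} (d : Fin n) xs i → i < length xs → nth d xs i ∈ xs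
nth-∈ d (x ∷ xs) zero    _        = ∈-head x xs
nth-∈ d (x ∷ xs) (suc i) (s≤s i<) = ∈-tail x xs (nth-∈ d xs i i<)

nth-injective : ∀ {n} (d : Fin n) {xs} i j → Distinct xs → i < length xs → j < length xs →
                nth d xs i ≡ nth d xs j → i ≡ j
nth-injective d {x ∷ xs} zero    zero    _  _        _        _  = refl
nth-injective d {x ∷ xs} zero    (suc j) dx _        (s≤s j<) eq =
  ⊥-elim (distinct-head x xs dx (subst (_∈ xs) (sym eq) (nth-∈ d xs j j<)))
nth-injective d {x ∷ xs} (suc i) zero    dx (s≤s i<) _        eq =
  ⊥-elim (distinct-head x xs dx (subst (_∈ xs) eq (nth-∈ d xs i i<)))
nth-injective d {x ∷ xs} (suc i) (suc j) dx (s≤s i<) (s≤s j<) eq =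
  cong suc (nth-injective d {xs} i j (distinct-tail x xs dx) i< j< eq)

-- If no window [p, p + 2k] with p ≤ 2k has both ends true, then a false value
-- at q forces one at q + 2 (through q + 1, q + 1 + 2k and q + 2 + 2k); starting
-- from position 0 or 1 this produces two consecutive false values around 2k.
module NoWindow (k : ℕ) (a : ℕ → Bool) (covered : ∀ i → i < 4 * suc k → T (a i ∨ a (suc i)))
                (noWindow : ∀ p → p ≤ 2 * suc k → T (a p) → ¬ T (a (p + 2 * suc k))) where

  d : ℕ
  d = 2 * suc k

  d≡ : d ≡ suc (suc (2 * k))
  d≡ = twice-suc k
    where twice-suc : ∀ k → 2 * suc k ≡ suc (suc (2 * k))
          twice-suc = solve-∀

  <4k : ∀ {i} → i < d + d → i < 4 * suc k
  <4k {i} = subst (i <_) (double (suc k))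
    where double : ∀ x → 2 * x + 2 * x ≡ 4 * x
          double = solve-∀

  next : ∀ i → i < d + d → ¬ T (a i) → T (a (suc i))
  next i i< ¬ai with a i | covered i (<4k i<)
  ... | true  | _    = ⊥-elim (¬ai _)
  ... | false | asi  = asi

  twoStep : ∀ q → suc (suc q) ≤ d → ¬ T (a q) → ¬ T (a (suc (suc q)))
  twoStep q q+2≤d ¬aq aq+2 = noWindow (suc (suc q)) q+2≤d aq+2 aq+2+d
    where
    aq+1   = next q (≤-trans (n≤1+n _) (≤-trans q+2≤d (m≤m+n d d))) ¬aq
    ¬aq+1+d = noWindow (suc q) (≤-trans (n≤1+n _) q+2≤d) aq+1
    aq+2+d = next (suc q + d) (+-monoˡ-≤ d q+2≤d) ¬aq+1+d

  stepsFalse : ∀ j q → q + 2 * j ≤ d → ¬ T (a q) → ¬ T (a (q + 2 * j))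
  stepsFalse zero    q _  ¬aq = subst (λ i → ¬ T (a i)) (sym (+-identityʳ q)) ¬aq
  stepsFalse (suc j) q le ¬aq = subst (λ i → ¬ T (a i)) (shift q j)
    (stepsFalse j (suc (suc q)) le′ (twoStep q (≤-trans (m≤m+n (suc (suc q)) (2 * j)) le′) ¬aq))
    where
    shift : ∀ q j → suc (suc q) + 2 * j ≡ q + 2 * suc j
    shift = solve-∀
    le′ : suc (suc q) + 2 * j ≤ d
    le′ = subst (_≤ d) (sym (shift q j)) le

  0<d : 0 < d
  0<d = subst (0 <_) (sym d≡) (s≤s z≤n)

  ¬ad : ¬ T (a d)
  ¬ad with T? (a 0)
  ... | yes a0 = noWindow 0 z≤n a0
  ... | no ¬a0 = stepsFalse (suc k) 0 ≤-refl ¬a0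

  absurd : ⊥
  absurd with T? (a 1)
  ... | yes a1 = noWindow 1 0<d a1 (next d (m<m+n d 0<d) ¬ad)
  ... | no ¬a1 = ¬ad (subst (T ∘ a) (sym d≡) (next (suc (2 * k)) d-1<2d (stepsFalse k 1 d-1≤d ¬a1)))
    where
    d-1≤d : suc (2 * k) ≤ d
    d-1≤d = subst (suc (2 * k) ≤_) (sym d≡) (n≤1+n _)
    d-1<2d : suc (2 * k) < d + d
    d-1<2d = subst (_≤ d + d) d≡ (m≤m+n d d)

window : ∀ k → 1 ≤ k → (a : ℕ → Bool) → (∀ i → i < 4 * k → T (a i ∨ a (suc i))) →
         ∃ λ p → p ≤ 2 * k × T (a p) × T (a (p + 2 * k))
window (suc k) _ a covered
  with any? {n = suc (2 * suc k)} (λ p → T? (a (toℕ p)) ×-dec T? (a (toℕ p + 2 * suc k)))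
... | yes (p , ap , apd) = toℕ p , ≤-pred (toℕ<n p) , ap , apd
... | no none = ⊥-elim (NoWindow.absurd k a covered noWindow)
  where
  noWindow : ∀ p → p ≤ 2 * suc k → T (a p) → ¬ T (a (p + 2 * suc k))
  noWindow p p≤ ap apd = none (fromℕ< (s≤s p≤) ,
    subst (T ∘ a) (sym (toℕ-fromℕ< (s≤s p≤))) ap ,
    subst (λ q → T (a (q + 2 * suc k))) (sym (toℕ-fromℕ< (s≤s p≤))) apd)

-- Paths indexed by ℕ, so that consecutive blocks are cut out by shifting.
record IxPath {n : ℕ} (H : Graph n) (M : ℕ) : Set where
  field
    at        : ℕ → Fin n
    linked    : ∀ i → suc i < M → T (adj H (at i) (at (suc i)))
    injective : ∀ i j → i < M → j < M → at i ≡ at j → i ≡ j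
open IxPath

module _ {n : ℕ} {H : Graph n} where

  list⇒IxPath : ∀ {M} x L → Linked (λ u v → T (adj H u v)) (x ∷ L) → Distinct (x ∷ L) →
                M ≤ length (x ∷ L) → IxPath H M
  list⇒IxPath x L l dL M≤ = record
    { at        = nth x (x ∷ L)
    ; linked    = λ i i< → nth-linked x i l (≤-trans i< M≤)
    ; injective = λ i j i< j< → nth-injective x {x ∷ L} i j dL (≤-trans i< M≤) (≤-trans j< M≤)
    }

  drop : ∀ s {M} → IxPath H (s + M) → IxPath H M
  drop s {M} Z = record
    { at        = λ i → at Z (s + i)
    ; linked    = λ i i< → subst (λ j → T (adj H (at Z (s + i)) (at Z j))) (sym (+-suc s i))
                                 (linked Z (s + i) (subst (_< s + M) (+-suc s i) (+-monoʳ-< s i<)))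
    ; injective = λ i j i< j< eq →
        +-cancelˡ-≡ s i j (injective Z (s + i) (s + j) (+-monoʳ-< s i<) (+-monoʳ-< s j<) eq)
    }

  segment : ∀ {M} → IxPath H M → ∀ p m → p + m < M → Path H (suc m)
  segment {M} Z p m p+m< = record
    { vert      = λ a → at Z (p + toℕ a)
    ; injective = λ a b eq →
        toℕ-injective (+-cancelˡ-≡ p _ _ (injective Z _ _ (bound a) (bound b) eq))
    ; adjacent  = λ a {b} b≡ →
        subst (λ j → T (adj H (at Z (p + toℕ a)) (at Z j))) (sym (next a b≡))
              (linked Z (p + toℕ a) (subst (_< M) (next a b≡) (bound b)))
    }
    where
    next : ∀ a {b : Fin (suc m)} → toℕ b ≡ suc (toℕ a) → p + toℕ b ≡ suc (p + toℕ a)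
    next a b≡ = trans (cong (p +_) b≡) (+-suc p (toℕ a))
    bound : ∀ (a : Fin (suc m)) → p + toℕ a < M
    bound a = ≤-trans (s≤s (+-monoʳ-≤ p (≤-pred (toℕ<n a)))) p+m<

path-mono : ∀ {n m} {H G : Graph n} → (∀ u v → T (adj H u v) → T (adj G u v)) →
            Path H m → Path G m
path-mono H⊆G P = record
  { vert = vert P ; injective = injective P ; adjacent = λ a b≡ → H⊆G _ _ (adjacent P a b≡) }

blockLength : (t : ℕ) → (Fin t → ℕ) → ℕ
blockLength t k = ∑[ i < t ] suc (4 * k i)

blockLength-∑ : ∀ t (k : Fin t → ℕ) → blockLength t k ≡ 4 * ∑[ i < t ] k i + t
blockLength-∑ zero    k = refl
blockLength-∑ (suc t) k = trans (cong (suc (4 * k zero) +_) (blockLength-∑ t (k ∘ suc)))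
                               (regroup (k zero) (∑[ i < t ] k (suc i)) t)
  where regroup : ∀ a s t → suc (4 * a) + (4 * s + t) ≡ 4 * (a + s) + suc t
        regroup = solve-∀

module Touching {n : ℕ} (G : Graph n) (U : Fin n → Bool) where

  touching : Graph n
  touching = record
    { adj    = λ u v → adj G u v ∧ (U u ∨ U v)
    ; sym    = λ u v → cong₂ _∧_ (Graph.sym G u v) (∨-comm (U u) (U v))
    ; irrefl = λ v → cong (_∧ (U v ∨ U v)) (Graph.irrefl G v)
    }

  touching⊆G : ∀ u v → T (adj touching u v) → T (adj G u v)
  touching⊆G u v e = proj₁ (to T-∧ e)

  touches : ∀ u v → T (adj touching u v) → T (U u ∨ U v)
  touches u v e = proj₂ (to T-∧ e)

  open EdgeCounting touching public using (Dense; twiceEdges)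

  crosses : Bool → Bool → Bool
  crosses p q = (p ∧ not q) ∨ (not p ∧ q)

  crosses-comm : ∀ p q → crosses p q ≡ crosses q p
  crosses-comm true  true  = refl
  crosses-comm true  false = refl
  crosses-comm false true  = refl
  crosses-comm false false = refl

  twiceEdges-all : 2 * (eIn G U + eCross G U) ≡ twiceEdges (λ _ → true)
  twiceEdges-all = begin
    2 * (eIn G U + eCross G U)
      ≡⟨ *-distribˡ-+ 2 (eIn G U) (eCross G U) ⟩
    2 * eIn G U + 2 * eCross G U
      ≡⟨ cong₂ _+_ (twice-countEdges (λ u v → U u ∧ U v) (λ u v → ∧-comm (U u) (U v)))
                   (twice-countEdges (λ u v → crosses (U u) (U v))
                                     (λ u v → crosses-comm (U u) (U v))) ⟩
    ∑[ u < n ] ∑[ v < n ] inner u v + ∑[ u < n ] ∑[ v < n ] across u v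
      ≡⟨ trans (sum-cong-≗ λ u → ∑-distrib-+ (inner u) (across u))
               (∑-distrib-+ (λ u → ∑[ v < n ] inner u v) (λ u → ∑[ v < n ] across u v)) ⟨
    ∑[ u < n ] ∑[ v < n ] (inner u v + across u v)
      ≡⟨ sum-cong-≗ (λ u → sum-cong-≗ λ v → split (adj G u v) (U u) (U v)) ⟩
    ∑[ u < n ] ∑[ v < n ] (1 * edge u v)
      ≡⟨ sum-cong-≗ (λ u → *-identityˡ (∑[ v < n ] (1 * edge u v))) ⟨
    twiceEdges (λ _ → true) ∎
    where
    open ≡-Reasoning
    inner across edge : Fin n → Fin n → ℕ
    inner  u v = bit (adj G u v ∧ (U u ∧ U v))
    across u v = bit (adj G u v ∧ crosses (U u) (U v))
    edge   u v = bit (adj touching u v)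
    open EdgeCounting G using (twice-countEdges)
    split : ∀ x p q → bit (x ∧ (p ∧ q)) + bit (x ∧ crosses p q) ≡ 1 * bit (x ∧ (p ∨ q))
    split false _     _     = refl
    split true  true  true  = refl
    split true  true  false = refl
    split true  false true  = refl
    split true  false false = refl

  twiceEdges-U : 2 * eIn G U ≡ twiceEdges U
  twiceEdges-U = begin
    2 * eIn G U
      ≡⟨ twice-countEdges (λ u v → U u ∧ U v) (λ u v → ∧-comm (U u) (U v)) ⟩
    ∑[ u < n ] ∑[ v < n ] bit (adj G u v ∧ (U u ∧ U v))
      ≡⟨ sum-cong-≗ (λ u → sum-cong-≗ λ v → inside (adj G u v) (U u) (U v)) ⟩
    ∑[ u < n ] ∑[ v < n ] (bit (U u) * (bit (U v) * edge u v))
      ≡⟨ sum-cong-≗ (λ u → *-distribˡ-sum (bit (U u)) (λ v → bit (U v) * edge u v)) ⟨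
    twiceEdges U ∎
    where
    open ≡-Reasoning
    open EdgeCounting G using (twice-countEdges)
    edge : Fin n → Fin n → ℕ
    edge u v = bit (adj touching u v)
    inside : ∀ x p q → bit (x ∧ (p ∧ q)) ≡ bit p * (bit q * bit (x ∧ (p ∨ q)))
    inside true  true  true  = refl
    inside true  true  false = refl
    inside true  false _     = refl
    inside false true  true  = refl
    inside false true  false = refl
    inside false false _     = refl

  UPaths : (t : ℕ) → (Fin t → ℕ) → Set
  UPaths t k = Σ ((i : Fin t) → Path G (suc (2 * k i))) λ P →
                 ((i : Fin t) → T (U (firstV (k i) (P i))) × T (U (lastV (k i) (P i)))) ×
                 (∀ i j a b → i ≢ j → vert (P i) a ≢ vert (P j) b)

  DrawnFrom : ∀ t k {M} → IxPath touching M → UPaths t k → Set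
  DrawnFrom t k {M} Z Ps = ∀ i a → ∃ λ q → q < M × vert (proj₁ Ps i) a ≡ at Z q

  uWindow : ∀ {M} k → 1 ≤ k → (Z : IxPath touching (suc (4 * k) + M)) →
            ∃ λ p → p + 2 * k < suc (4 * k) × T (U (at Z p)) × T (U (at Z (p + 2 * k)))
  uWindow {M} k 1≤k Z =
    let p , p≤ , Up , Up+2k = window k 1≤k (U ∘ at Z) covered
    in  p , s≤s (≤-trans (+-monoˡ-≤ (2 * k) p≤) (≤-reflexive (double k))) , Up , Up+2k
    where
    covered : ∀ i → i < 4 * k → T (U (at Z i) ∨ U (at Z (suc i)))
    covered i i< = touches _ _ (linked Z i (≤-trans (s≤s i<) (m≤m+n (suc (4 * k)) M)))
    double : ∀ x → 2 * x + 2 * x ≡ 4 * x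
    double = solve-∀

  chop : ∀ t (k : Fin t → ℕ) → (∀ i → 1 ≤ k i) → (Z : IxPath touching (blockLength t k)) →
         Σ (UPaths t k) (DrawnFrom t k Z)
  chop zero    k _   Z = ((λ ()) , (λ ()) , λ ()) , λ ()
  chop (suc t) k 1≤k Z = (paths , ends , disjoint) , drawn
    where
    k₀ = k zero
    s₀ = suc (4 * k₀)
    M′ = blockLength t (k ∘ suc)
    win = uWindow k₀ (1≤k zero) Z
    p = proj₁ win
    inFirst : ∀ (a : Fin (suc (2 * k₀))) → p + toℕ a < s₀
    inFirst a = ≤-trans (s≤s (+-monoʳ-≤ p (≤-pred (toℕ<n a)))) (proj₁ (proj₂ win))
    rest : Σ (UPaths t (k ∘ suc)) (DrawnFrom t (k ∘ suc) (drop s₀ Z))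
    rest = chop t (k ∘ suc) (1≤k ∘ suc) (drop s₀ Z)
    paths : (i : Fin (suc t)) → Path G (suc (2 * k i))
    paths zero    = path-mono touching⊆G
                      (segment Z p (2 * k₀) (≤-trans (proj₁ (proj₂ win)) (m≤m+n s₀ M′)))
    paths (suc i) = proj₁ (proj₁ rest) i
    ends : (i : Fin (suc t)) → T (U (firstV (k i) (paths i))) × T (U (lastV (k i) (paths i)))
    ends zero    = subst (T ∘ U ∘ at Z) (sym (+-identityʳ p)) (proj₁ (proj₂ (proj₂ win))) ,
                   subst (T ∘ U ∘ at Z) (cong (p +_) (sym (toℕ-fromℕ (2 * k₀))))
                         (proj₂ (proj₂ (proj₂ win)))
    ends (suc i) = proj₁ (proj₂ (proj₁ rest)) i
    later : ∀ i a → ∃ λ q → q < M′ × vert (paths (suc i)) a ≡ at Z (s₀ + q)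
    later = proj₂ rest
    apart : ∀ a q → q < M′ → at Z (p + toℕ a) ≢ at Z (s₀ + q)
    apart a q q< eq = <⇒≱ (inFirst a) (≤-trans (m≤m+n s₀ q) (≤-reflexive (sym
      (injective Z _ _ (≤-trans (inFirst a) (m≤m+n s₀ M′)) (+-monoʳ-< s₀ q<) eq))))
    disjoint : ∀ i j a b → i ≢ j → vert (paths i) a ≢ vert (paths j) b
    disjoint zero    zero    a b i≢j _  = i≢j refl
    disjoint zero    (suc j) a b _   eq = let q , q< , eqb = later j b in apart a q q< (trans eq eqb)
    disjoint (suc i) zero    a b _   eq = let q , q< , eqa = later i a in apart b q q< (trans (sym eq) eqa)
    disjoint (suc i) (suc j) a b i≢j eq = proj₂ (proj₂ (proj₁ rest)) i j a b (i≢j ∘ cong suc) eq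
    drawn : DrawnFrom (suc t) k Z (paths , ends , disjoint)
    drawn zero    a = p + toℕ a , ≤-trans (inFirst a) (m≤m+n s₀ M′) , refl
    drawn (suc i) a = let q , q< , eq = later i a in s₀ + q , +-monoʳ-< s₀ q< , eq

  dense⇒UPaths : ∀ {c} t k → (∀ i → 1 ≤ k i) → blockLength t k ≡ suc (suc c) →
                 ∀ S → Dense c S → UPaths t k
  dense⇒UPaths {c} t k 1≤k blocks S dense with LongPaths.dense⇒longPath touching c S dense
  ... | x ∷ L , linked , distinct , long =
    proj₁ (chop t k 1≤k (list⇒IxPath x L linked distinct
                                       (subst (_≤ length (x ∷ L)) (sym blocks) long)))

blockLength≡ : ∀ t (k : Fin t → ℕ) → 1 ≤ t → (∀ i → 1 ≤ k i) →
               blockLength t k ≡ suc (suc (4 * Σfin t k + t ∸ 2))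
blockLength≡ (suc t) k _ 1≤k = begin
  blockLength (suc t) k                          ≡⟨ blockLength-∑ (suc t) k ⟩
  4 * ∑[ i < suc t ] k i + suc t                 ≡⟨ cong (λ s → 4 * s + suc t) (Σfin≡∑ (suc t) k) ⟨
  4 * κ + suc t                                  ≡⟨ m∸n+n≡m 2≤ ⟨
  4 * κ + suc t ∸ 2 + 2                          ≡⟨ +-comm _ 2 ⟩
  suc (suc (4 * κ + suc t ∸ 2))                  ∎
  where
  open ≡-Reasoning
  κ = Σfin (suc t) k
  κ≥1 : 1 ≤ κ
  κ≥1 = subst (1 ≤_) (sym (Σfin≡∑ (suc t) k)) (≤-trans (1≤k zero) (m≤m+n (k zero) _))
  2≤ : 2 ≤ 4 * κ + suc t
  2≤ = ≤-trans (≤-trans (s≤s (s≤s z≤n)) (*-monoʳ-≤ 4 κ≥1)) (m≤m+n (4 * κ) (suc t))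

excess-inside : ∀ c u n a b → c * (u + n) < 2 * (2 * a + b) → 2 * (a + b) ≤ c * n → c * u < 2 * a
excess-inside c u n a b total< outside≤ = +-cancelʳ-< (c * n) (c * u) (2 * a) (begin-strict
  c * u + c * n          ≡⟨ *-distribˡ-+ c u n ⟨
  c * (u + n)            <⟨ total< ⟩
  2 * (2 * a + b)        ≡⟨ regroup a b ⟩
  2 * a + 2 * (a + b)    ≤⟨ +-monoʳ-≤ (2 * a) outside≤ ⟩
  2 * a + c * n          ∎)
  where
  open ≤-Reasoning
  regroup : ∀ a b → 2 * (2 * a + b) ≡ 2 * a + 2 * (a + b)
  regroup = solve-∀

lemma3p5 : (t : ℕ) → 1 ≤ t → (k : Fin t → ℕ) → (∀ i → 1 ≤ k i) →
    (n : ℕ) (G : Graph n) (U : Fin n → Bool) →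
    let κ = Σfin t k
        c = 4 * κ + t ∸ 2
        Concl = Σ ((i : Fin t) → Path G (suc (2 * k i))) λ P →
                  ((i : Fin t) → T (U (firstV (k i) (P i))) × T (U (lastV (k i) (P i)))) ×
                  (∀ i j a b → i ≢ j → vert (P i) a ≢ vert (P j) b)
    in ((c * n < 2 * (eIn G U + eCross G U)) → Concl) ×
       ((c * (card U + n) < 2 * (2 * eIn G U + eCross G U)) → Concl)
lemma3p5 t 1≤t k 1≤k n G U = part₁ , part₂
  where
  open Touching G U
  c = 4 * Σfin t k + t ∸ 2

  found : ∀ S → Dense c S → UPaths t k
  found = dense⇒UPaths t k 1≤k (blockLength≡ t k 1≤t 1≤k)

  part₁ : c * n < 2 * (eIn G U + eCross G U) → UPaths t k
  part₁ h = found (λ _ → true) (subst₂ (λ m e → c * m < e) (sym (∑-ones n)) twiceEdges-all h)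

  part₂ : c * (card U + n) < 2 * (2 * eIn G U + eCross G U) → UPaths t k
  part₂ h with c * n <? 2 * (eIn G U + eCross G U)
  ... | yes h₁ = part₁ h₁
  ... | no ¬h₁ = found U (subst₂ (λ m e → c * m < e) (Σfin≡∑ n (bit ∘ U)) twiceEdges-U
                   (excess-inside c (card U) n (eIn G U) (eCross G U) h (≮⇒≥ ¬h₁)))
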